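{- For $n\ge1$ let $g_n=g_n(x)=\sum_{v\in V(\mathcal{R}_n)}x^{\deg(v)}$ be the degree enumerator polynomial of the Fibonacci-run graph $\mathcal{R}_n$. Then for all $n\ge12$, $$g_n=xg_{n-1}+2g_{n-2}-xg_{n-3}-g_{n-4}+x(x-1)g_{n-5}-x(x^2-1)g_{n-7}-2x^2(x-1)^2g_{n-9}-x^2(x-1)^3g_{n-11}.$$
   Context: A binary string is run-constrained if every run of 1s in it is immediately followed by a run of 0s of strictly greater length (the empty string counts as run-constrained). For $n\ge1$ the Fibonacci-run graph $\mathcal{R}_n$ has vertex set $\{w\in\{0,1\}^n : w00 \text{ is run-constrained}\}$, two vertices being adjacent iff they differ in exactly one coordinate; $\deg(v)$ is the degree of $v$ in $\mathcal{R}_n$. -}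

module Defs where

open import Data.Bool using (Bool; true; false; _∧_; not; T)
open import Data.Nat using (ℕ; zero; suc; _<ᵇ_; _≡ᵇ_)
open import Data.List using (List; []; _∷_; _++_; map; filter; length)
open import Data.Integer using (ℤ; +_; _-_) renaming (_+_ to _+ℤ_)
open import Relation.Nullary.Decidable using (Dec; yes; no)
open import Relation.Unary using (Decidable)

-- Run-constrained binary strings (true = 1, false = 0).
-- A string is run-constrained iff every maximal run of 1s is immediately
-- followed by a run of 0s of strictly greater length.  Decided by a
-- scan: `ones k` = we are inside a run of k ≥ 1 ones; `zeros k m` = the
-- last run of ones had length k and we have seen m zeros after it.

mutual
  ones : ℕ → List Bool → Bool
  ones k []          = false
  ones k (true ∷ w)  = ones (suc k) w
  ones k (false ∷ w) = zeros k 1 w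

  zeros : ℕ → ℕ → List Bool → Bool
  zeros k m []          = k <ᵇ m
  zeros k m (false ∷ w) = zeros k (suc m) w
  zeros k m (true ∷ w)  = (k <ᵇ m) ∧ ones 1 w

runConstrained? : List Bool → Bool
runConstrained? []          = true
runConstrained? (false ∷ w) = runConstrained? w
runConstrained? (true ∷ w)  = ones 1 w

RunConstrained : List Bool → Set
RunConstrained w = T (runConstrained? w)

strings : ℕ → List (List Bool)
strings zero    = [] ∷ []
strings (suc n) = map (false ∷_) (strings n) ++ map (true ∷_) (strings n)

decT : (b : Bool) → Dec (T b)
decT true  = yes _
decT false = no (λ ())

vertices : ℕ → List (List Bool)
vertices n = filter (λ w → decT (runConstrained? (w ++ false ∷ false ∷ []))) (strings n)

hamming : List Bool → List Bool → ℕ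
hamming []       _        = 0
hamming (_ ∷ _)  []       = 0
hamming (a ∷ u)  (b ∷ w)  = (if-xor a b) Data.Nat.+ hamming u w
  where
  if-xor : Bool → Bool → ℕ
  if-xor true  false = 1
  if-xor false true  = 1
  if-xor _     _     = 0

adjacent? : List Bool → List Bool → Bool
adjacent? u w = hamming u w ≡ᵇ 1

deg : ℕ → List Bool → ℕ
deg n v = length (filter (λ w → decT (adjacent? v w)) (vertices n))

-- Polynomials in ℤ[x], represented by their coefficient sequences
-- (coefficient of x^k at index k); equality of polynomials is
-- coefficientwise equality.

Poly : Set
Poly = ℕ → ℤ

X· : Poly → Poly
X· p zero    = + 0
X· p (suc k) = p k

_⊕_ : Poly → Poly → Poly
(p ⊕ q) k = p k +ℤ q k
infixl 6 _⊕_ _⊖_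

_⊖_ : Poly → Poly → Poly
(p ⊖ q) k = p k - q k

X-1· : Poly → Poly
X-1· p = X· p ⊖ p

-- Degree enumerator polynomial g_n(x) = Σ_{v ∈ V(R_n)} x^{deg v}:
-- its k-th coefficient is the number of vertices of degree k.
g : ℕ → Poly
g n k = + length (filter (λ v → decT (deg n v ≡ᵇ k)) (vertices n))

-- Membership in V(R_n) is recognised, letter by letter, by a finite automaton (a run of d + 1 ones
-- must be followed by d + 2 zeros, two of which the suffix 00 provides), and the degree of v counts
-- the one-letter changes of v that are still accepted. Splitting words at their first letter refines
-- the degree enumerator g_n into enumerators that also record the automaton states of the changes
-- made so far; those changed words read the same remaining suffix, so each contributes one more
-- neighbour exactly when its state accepts. Thirteen such enumerators satisfy a first-order linear
-- system V(n+1) = step V(n) over ℤ[x]. Running the system symbolically expresses g_{n-i}, i < 12,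
-- as ℤ[x]-linear forms in the entries of V(n-13), and the recurrence is the identity that the form
-- of g_n minus the right-hand side is zero, which is decided by evaluation.

module Submission where

open import Defs
open import Data.Bool using (Bool; true; false; T; _∧_; not; if_then_else_)
open import Data.Bool.Properties using (T-∧; T-≡; ∧-zeroʳ)
open import Data.Empty using (⊥-elim)
open import Data.Fin using (Fin; zero; suc; toℕ; #_)
open import Data.Fin.Properties using (toℕ≤n)
open import Data.Integer using (ℤ; +_; -_; _*_) renaming (_+_ to _+ℤ_)
import Data.Integer.Properties as ℤ
open import Algebra.Properties.CommutativeSemigroup ℤ.+-commutativeSemigroup using (interchange)
open import Data.List using (List; []; _∷_; _++_; map; filter; length)
open import Data.List.Properties using (map-∘)
open import Data.List.Relation.Binary.Permutation.Propositional using (_↭_)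
open import Data.List.Relation.Binary.Permutation.Propositional.Properties using (shift; map⁺)
open import Data.Nat using (ℕ; zero; suc; _≤_; _∸_; _≡ᵇ_) renaming (_+_ to _+ℕ_)
open import Data.Nat.ListAction using (sum)
open import Data.Nat.ListAction.Properties using (sum-↭)
open import Data.Nat.Properties
  using ( +-comm; +-assoc; +-suc; +-identityʳ; 0∸n≡0; +-∸-comm; +-∸-assoc
        ; ≤-trans; m≤m+n; m≤n⇒m≤1+n; m≤n⇒∃[o]m+o≡n)
open import Data.Product using (_,_; proj₁; proj₂)
open import Data.Unit using (tt)
open import Data.Vec using (Vec; []; _∷_; tabulate; lookup; replicate; zipWith)
import Data.Vec as Vec
open import Data.Vec.Properties using (tabulate∘lookup)
open import Data.Vec.Relation.Binary.Pointwise.Inductive as Pointwise using (Pointwise; []; _∷_; tabulate⁺)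
open import Function.Bundles using (Equivalence)
open import Relation.Binary.Bundles using (Setoid)
open import Relation.Binary.PropositionalEquality
import Relation.Binary.Reasoning.Setoid as SetoidReasoning

0ₚ 1ₚ : Poly
0ₚ _ = + 0
1ₚ zero    = + 1
1ₚ (suc _) = + 0

⊝_ : Poly → Poly
(⊝ p) k = - p k

open Setoid (ℕ →-setoid ℤ) using () renaming (refl to ≗-refl; sym to ≗-sym; trans to ≗-trans)
module ≗-Reasoning = SetoidReasoning (ℕ →-setoid ℤ)

⊕-cong : ∀ {p p′ q q′} → p ≗ p′ → q ≗ q′ → p ⊕ q ≗ p′ ⊕ q′
⊕-cong e e′ k = cong₂ _+ℤ_ (e k) (e′ k)

⊖-cong : ∀ {p p′ q q′} → p ≗ p′ → q ≗ q′ → p ⊖ q ≗ p′ ⊖ q′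
⊖-cong e e′ k = cong₂ _+ℤ_ (e k) (cong -_ (e′ k))

⊕-congˡ : ∀ p {q q′} → q ≗ q′ → p ⊕ q ≗ p ⊕ q′
⊕-congˡ p e k = cong (p k +ℤ_) (e k)

⊕-identityʳ : ∀ p → p ⊕ 0ₚ ≗ p
⊕-identityʳ p k = ℤ.+-identityʳ (p k)

X·-cong : ∀ {p q} → p ≗ q → X· p ≗ X· q
X·-cong e zero    = refl
X·-cong e (suc k) = e k

X·-0ₚ : X· 0ₚ ≗ 0ₚ
X·-0ₚ zero    = refl
X·-0ₚ (suc k) = refl

X·-⊕ : ∀ p q → X· (p ⊕ q) ≗ X· p ⊕ X· q
X·-⊕ p q zero    = refl
X·-⊕ p q (suc k) = refl

X·-⊝ : ∀ p → X· (⊝ p) ≗ ⊝ X· p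
X·-⊝ p zero    = refl
X·-⊝ p (suc k) = refl

-- inRun d: inside a run of d + 1 ones; owing d: that run still needs d + 1 more zeros.
-- Acceptance already counts the two zeros of the suffix 00.
data State : Set where
  free  : State
  inRun : ℕ → State
  owing : ℕ → State
  dead  : State

δ : State → Bool → State
δ free            false = free
δ free            true  = inRun 0
δ (inRun d)       false = owing d
δ (inRun d)       true  = inRun (suc d)
δ (owing _)       true  = dead
δ (owing zero)    false = free
δ (owing (suc d)) false = owing d
δ dead            _     = dead

final : State → Bool
final free                  = true
final (inRun zero)          = true
final (inRun (suc _))       = false
final (owing zero)          = true
final (owing (suc zero))    = true
final (owing (suc (suc _))) = false
final dead                  = false

accepts : State → List Bool → Bool
accepts s []      = final s
accepts s (a ∷ w) = accepts (δ s a) w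

accepts-dead : ∀ u → accepts dead u ≡ false
accepts-dead []      = refl
accepts-dead (_ ∷ u) = accepts-dead u

pad00 : List Bool
pad00 = false ∷ false ∷ []

zeros-shift : ∀ k m w → zeros (suc k) (suc m) w ≡ zeros k m w
zeros-shift k m []          = refl
zeros-shift k m (false ∷ w) = zeros-shift k (suc m) w
zeros-shift k m (true ∷ w)  = refl

mutual
  ones-++00 : ∀ k w → ones (suc k) (w ++ pad00) ≡ accepts (inRun k) w
  ones-++00 zero    []          = refl
  ones-++00 (suc k) []          = refl
  ones-++00 k       (true ∷ w)  = ones-++00 (suc k) w
  ones-++00 k       (false ∷ w) = trans (zeros-shift k 0 (w ++ pad00)) (zeros-++00 k w)

  zeros-++00 : ∀ j w → zeros j 0 (w ++ pad00) ≡ accepts (owing j) w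
  zeros-++00 zero          []          = refl
  zeros-++00 (suc zero)    []          = refl
  zeros-++00 (suc (suc j)) []          = refl
  zeros-++00 j             (true ∷ w)  = sym (accepts-dead w)
  zeros-++00 zero          (false ∷ w) = zeros-free-++00 0 w
  zeros-++00 (suc j)       (false ∷ w) = trans (zeros-shift j 0 (w ++ pad00)) (zeros-++00 j w)

  zeros-free-++00 : ∀ m w → zeros 0 (suc m) (w ++ pad00) ≡ accepts free w
  zeros-free-++00 m []          = refl
  zeros-free-++00 m (false ∷ w) = zeros-free-++00 (suc m) w
  zeros-free-++00 m (true ∷ w)  = ones-++00 0 w

runConstrained-++00 : ∀ w → runConstrained? (w ++ pad00) ≡ accepts free w
runConstrained-++00 []          = refl
runConstrained-++00 (false ∷ w) = runConstrained-++00 w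
runConstrained-++00 (true ∷ w)  = ones-++00 0 w

infix 4 _≼_
_≼_ : State → State → Set
s ≼ t = ∀ u → T (accepts s u) → T (accepts t u)

dead-rejects : ∀ {A : Set} u → T (accepts dead u) → A
dead-rejects u h = ⊥-elim (subst T (accepts-dead u) h)

owing≼free : ∀ d → owing d ≼ free
owing≼free d       []          _ = tt
owing≼free d       (true ∷ u)  h = dead-rejects u h
owing≼free zero    (false ∷ u) h = h
owing≼free (suc d) (false ∷ u) h = owing≼free d u h

owing-suc≼owing : ∀ d → owing (suc d) ≼ owing d
owing-suc≼owing zero    []          _ = tt
owing-suc≼owing (suc d) []          ()
owing-suc≼owing d       (true ∷ u)  h = dead-rejects u h
owing-suc≼owing zero    (false ∷ u) h = owing≼free 0 u h
owing-suc≼owing (suc d) (false ∷ u) h = owing-suc≼owing d u h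

inRun-suc≼inRun : ∀ d → inRun (suc d) ≼ inRun d
inRun-suc≼inRun d []          ()
inRun-suc≼inRun d (false ∷ u) h = owing-suc≼owing d u h
inRun-suc≼inRun d (true ∷ u)  h = inRun-suc≼inRun (suc d) u h

inRun0≼free : inRun 0 ≼ free
inRun0≼free []          _ = tt
inRun0≼free (false ∷ u) h = owing≼free 0 u h
inRun0≼free (true ∷ u)  h = inRun-suc≼inRun 0 u h

owing-suc≼δ-owing : ∀ d → owing (suc d) ≼ δ (owing d) false
owing-suc≼δ-owing zero    = owing≼free 1
owing-suc≼δ-owing (suc d) u h = owing-suc≼owing d u (owing-suc≼owing (suc d) u h)

inRun-suc≈owing : ∀ d u → T (accepts (owing d) u) → accepts (inRun (suc d)) u ≡ accepts (owing (2 +ℕ d)) u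
inRun-suc≈owing d []          _ = refl
inRun-suc≈owing d (false ∷ u) _ = refl
inRun-suc≈owing d (true ∷ u)  h = dead-rejects u h

count : (List Bool → Bool) → List (List Bool) → ℕ
count p []       = 0
count p (w ∷ ws) = if p w then suc (count p ws) else count p ws

count-++ : ∀ p xs ys → count p (xs ++ ys) ≡ count p xs +ℕ count p ys
count-++ p []       ys = refl
count-++ p (x ∷ xs) ys with p x
... | true  = cong suc (count-++ p xs ys)
... | false = count-++ p xs ys

count-map : ∀ p f xs → count p (map f xs) ≡ count (λ w → p (f w)) xs
count-map p f []       = refl
count-map p f (x ∷ xs) = cong (λ c → if p (f x) then suc c else c) (count-map p f xs)

count-cong : ∀ {p q} xs → (∀ w → p w ≡ q w) → count p xs ≡ count q xs
count-cong         []       e = refl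
count-cong {q = q} (x ∷ xs) e rewrite e x = cong (λ c → if q x then suc c else c) (count-cong xs e)

count-none : ∀ {p} xs → (∀ w → p w ≡ false) → count p xs ≡ 0
count-none []       e = refl
count-none (x ∷ xs) e rewrite e x = count-none xs e

count-strings : ∀ p n →
  count p (strings (suc n)) ≡ count (λ w → p (false ∷ w)) (strings n) +ℕ count (λ w → p (true ∷ w)) (strings n)
count-strings p n = trans (count-++ p (map (false ∷_) (strings n)) (map (true ∷_) (strings n)))
  (cong₂ _+ℕ_ (count-map p (false ∷_) (strings n)) (count-map p (true ∷_) (strings n)))

count-strings-cong : ∀ {p q} n → (∀ v → length v ≡ n → p v ≡ q v) → count p (strings n) ≡ count q (strings n)
count-strings-cong zero e rewrite e [] refl = refl
count-strings-cong {p} {q} (suc n) e = begin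
  count p (strings (suc n))
    ≡⟨ count-strings p n ⟩
  count (λ w → p (false ∷ w)) (strings n) +ℕ count (λ w → p (true ∷ w)) (strings n)
    ≡⟨ cong₂ _+ℕ_ (count-strings-cong n (λ v lv → e (false ∷ v) (cong suc lv)))
                  (count-strings-cong n (λ v lv → e (true ∷ v) (cong suc lv))) ⟩
  count (λ w → q (false ∷ w)) (strings n) +ℕ count (λ w → q (true ∷ w)) (strings n)
    ≡⟨ count-strings q n ⟨
  count q (strings (suc n)) ∎
  where open ≡-Reasoning

length-filter-filter : ∀ (p q : List Bool → Bool) xs →
  length (filter (λ w → decT (q w)) (filter (λ w → decT (p w)) xs)) ≡ count (λ w → p w ∧ q w) xs
length-filter-filter p q []       = refl
length-filter-filter p q (x ∷ xs) with p x
... | false = length-filter-filter p q xs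
... | true with q x
...   | true  = cong suc (length-filter-filter p q xs)
...   | false = length-filter-filter p q xs

∧-cong-T : ∀ a {b c} → (T a → b ≡ c) → a ∧ b ≡ a ∧ c
∧-cong-T true  h = h tt
∧-cong-T false h = refl

indicator : Bool → ℕ
indicator true  = 1
indicator false = 0

neighbours : State → List Bool → ℕ
neighbours s []      = 0
neighbours s (a ∷ u) = indicator (accepts (δ s (not a)) u) +ℕ neighbours (δ s a) u

count-equal : ∀ s v →
  count (λ w → accepts s w ∧ (hamming v w ≡ᵇ 0)) (strings (length v)) ≡ indicator (accepts s v)
count-equal s [] with accepts s []
... | true  = refl
... | false = refl
count-equal s (false ∷ v) = trans (count-strings _ (length v))
  (trans (cong₂ _+ℕ_ (count-equal (δ s false) v)
                     (count-none (strings (length v)) (λ w → ∧-zeroʳ (accepts (δ s true) w))))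
         (+-identityʳ _))
count-equal s (true ∷ v) = trans (count-strings _ (length v))
  (cong₂ _+ℕ_ (count-none (strings (length v)) (λ w → ∧-zeroʳ (accepts (δ s false) w)))
              (count-equal (δ s true) v))

count-adjacent : ∀ s v →
  count (λ w → accepts s w ∧ (hamming v w ≡ᵇ 1)) (strings (length v)) ≡ neighbours s v
count-adjacent s [] with accepts s []
... | true  = refl
... | false = refl
count-adjacent s (false ∷ v) = trans (count-strings _ (length v))
  (trans (cong₂ _+ℕ_ (count-adjacent (δ s false) v) (count-equal (δ s true) v))
         (+-comm (neighbours (δ s false) v) _))
count-adjacent s (true ∷ v) = trans (count-strings _ (length v))
  (cong₂ _+ℕ_ (count-equal (δ s false) v) (count-adjacent (δ s true) v))

deg≡neighbours : ∀ n v → length v ≡ n → deg n v ≡ neighbours free v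
deg≡neighbours _ v refl =
  trans (length-filter-filter (λ w → runConstrained? (w ++ pad00)) (adjacent? v) (strings (length v)))
  (trans (count-cong (strings (length v)) (λ w → cong (_∧ (hamming v w ≡ᵇ 1)) (runConstrained-++00 w)))
         (count-adjacent free v))

#accepting : List State → List Bool → ℕ
#accepting ts u = sum (map (λ t → indicator (accepts t u)) ts)

-- The context ts holds the states reached by changing one earlier letter; those words read the
-- same remaining suffix, so each one accepting it is one more neighbour.
enum : State → List State → ℕ → Poly
enum s ts n k = + count (λ u → accepts s u ∧ (neighbours s u +ℕ #accepting ts u ≡ᵇ k)) (strings n)

g≗enum : ∀ n → g n ≗ enum free [] n
g≗enum n k = cong +_
  (trans (length-filter-filter (λ w → runConstrained? (w ++ pad00)) (λ v → deg n v ≡ᵇ k) (strings n))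
         (count-strings-cong n (λ v lv → cong₂ (λ a b → a ∧ (b ≡ᵇ k)) (runConstrained-++00 v)
                                               (trans (deg≡neighbours n v lv) (sym (+-identityʳ _))))))

#accepting-step : ∀ ts a u → #accepting ts (a ∷ u) ≡ #accepting (map (λ t → δ t a) ts) u
#accepting-step ts a u = cong sum (map-∘ ts)

enum-step : ∀ s ts n →
  enum s ts (suc n) ≗
  enum (δ s false) (δ s true ∷ map (λ t → δ t false) ts) n ⊕
  enum (δ s true) (δ s false ∷ map (λ t → δ t true) ts) n
enum-step s ts n k = cong +_
  (trans (count-strings _ n) (cong₂ _+ℕ_ (count-cong (strings n) (first false)) (count-cong (strings n) (first true))))
  where
  first : ∀ a u →
    (accepts (δ s a) u ∧ (neighbours s (a ∷ u) +ℕ #accepting ts (a ∷ u) ≡ᵇ k)) ≡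
    (accepts (δ s a) u ∧ (neighbours (δ s a) u +ℕ #accepting (δ s (not a) ∷ map (λ t → δ t a) ts) u ≡ᵇ k))
  first a u = cong (λ c → accepts (δ s a) u ∧ (c ≡ᵇ k))
    (trans (cong (_+ℕ #accepting ts (a ∷ u)) (+-comm (indicator (accepts (δ s (not a)) u)) _))
    (trans (+-assoc (neighbours (δ s a) u) _ _)
           (cong (λ c → neighbours (δ s a) u +ℕ (indicator (accepts (δ s (not a)) u) +ℕ c)) (#accepting-step ts a u))))

enum-cong : ∀ s {ts ts′} n → (∀ u → T (accepts s u) → #accepting ts u ≡ #accepting ts′ u) →
  enum s ts n ≗ enum s ts′ n
enum-cong s n h k = cong +_ (count-cong (strings n)
  (λ u → ∧-cong-T (accepts s u) (λ a → cong (λ c → neighbours s u +ℕ c ≡ᵇ k) (h u a))))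

enum-↭ : ∀ s {ts ts′} n → ts ↭ ts′ → enum s ts n ≗ enum s ts′ n
enum-↭ s {ts} {ts′} n p = enum-cong s {ts} {ts′} n (λ u _ → sum-↭ (map⁺ (λ t → indicator (accepts t u)) p))

enum-agree : ∀ s {t t′} ts n → (∀ u → T (accepts s u) → accepts t u ≡ accepts t′ u) →
  enum s (t ∷ ts) n ≗ enum s (t′ ∷ ts) n
enum-agree s {t} {t′} ts n h =
  enum-cong s {t ∷ ts} {t′ ∷ ts} n (λ u a → cong (λ b → indicator b +ℕ #accepting ts u) (h u a))

enum-drop-dead : ∀ s xs ys n → enum s (xs ++ dead ∷ ys) n ≗ enum s (xs ++ ys) n
enum-drop-dead s xs ys n = ≗-trans (enum-↭ s n (shift dead xs ys))
  (enum-cong s {dead ∷ xs ++ ys} {xs ++ ys} n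
    (λ u _ → cong (λ b → indicator b +ℕ #accepting (xs ++ ys) u) (accepts-dead u)))

enum-absorb : ∀ {s t} ts n → s ≼ t → enum s (t ∷ ts) n ≗ X· (enum s ts n)
enum-absorb {s} {t} ts n s≼t = absorb
  where
  one-more : ∀ u → T (accepts s u) →
    neighbours s u +ℕ #accepting (t ∷ ts) u ≡ suc (neighbours s u +ℕ #accepting ts u)
  one-more u a = trans (cong (λ b → neighbours s u +ℕ (indicator b +ℕ #accepting ts u))
                             (Equivalence.to T-≡ (s≼t u a)))
                       (+-suc _ _)

  absorb : enum s (t ∷ ts) n ≗ X· (enum s ts n)
  absorb zero = cong +_ (count-none (strings n)
    (λ u → trans (∧-cong-T (accepts s u) (λ a → cong (_≡ᵇ 0) (one-more u a))) (∧-zeroʳ _)))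
  absorb (suc k) = cong +_ (count-cong (strings n)
    (λ u → ∧-cong-T (accepts s u) (λ a → cong (_≡ᵇ suc k) (one-more u a))))

enum-dead : ∀ ts n → enum dead ts n ≗ 0ₚ
enum-dead ts n k = cong +_ (count-none (strings n)
  (λ u → cong (λ b → b ∧ (neighbours dead u +ℕ #accepting ts u ≡ᵇ k)) (accepts-dead u)))

enum-owing-step : ∀ d ts n → enum (owing d) ts (suc n) ≗ enum (δ (owing d) false) (map (λ t → δ t false) ts) n
enum-owing-step d ts n = ≗-trans (enum-step (owing d) ts n)
  (≗-trans (⊕-cong (enum-drop-dead _ [] (map (λ t → δ t false) ts) n)
                   (enum-dead (δ (owing d) false ∷ map (λ t → δ t true) ts) n))
           (⊕-identityʳ _))

-- P and Q extend n ↦ enum free (owing 1 ∷ []) (n ∸ 3), resp. enum free (owing 1 ∷ owing 0 ∷ []) (n ∸ 3),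
-- below 3 by the values that make enum-owing≗P and enum-owing≗Q hold for all lengths.
P Q : ℕ → Poly
P 0 = 0ₚ
P 1 = 1ₚ
P 2 = 1ₚ
P (suc (suc (suc n))) = enum free (owing 1 ∷ []) n
Q 0 = 0ₚ
Q 1 = 1ₚ
Q 2 = X· 1ₚ
Q (suc (suc (suc n))) = enum free (owing 1 ∷ owing 0 ∷ []) n

-- skipSum f j = x (f j + f (j ∸ 2) + …), over the positive indices of that parity;
-- skipSum′ f j = skipSum f (j ∸ 1).
mutual
  skipSum : (ℕ → Poly) → ℕ → Poly
  skipSum f zero    = 0ₚ
  skipSum f (suc j) = X· (f (suc j)) ⊕ skipSum′ f j

  skipSum′ : (ℕ → Poly) → ℕ → Poly
  skipSum′ f zero    = 0ₚ
  skipSum′ f (suc j) = skipSum f j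

skipSum-step : ∀ f → f 0 ≗ 0ₚ → ∀ n d →
  X· (f (suc n ∸ d)) ⊕ skipSum f (n ∸ suc d) ≗ skipSum f (suc n ∸ d)
skipSum-step f f0 zero    zero    k = refl
skipSum-step f f0 (suc n) zero    k = refl
skipSum-step f f0 zero    (suc d) k rewrite 0∸n≡0 d =
  trans (ℤ.+-identityʳ _) (≗-trans (X·-cong f0) X·-0ₚ k)
skipSum-step f f0 (suc n) (suc d) k = skipSum-step f f0 n d k

enum-owing≗P : ∀ n d → enum (owing d) (owing (2 +ℕ d) ∷ []) n ≗ P (2 +ℕ n ∸ d)
enum-owing≗P zero    zero          zero    = refl
enum-owing≗P zero    zero          (suc k) = refl
enum-owing≗P zero    (suc zero)    zero    = refl
enum-owing≗P zero    (suc zero)    (suc k) = refl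
enum-owing≗P zero    (suc (suc d)) k rewrite 0∸n≡0 d = refl
enum-owing≗P (suc n) zero          = enum-owing-step 0 (owing 2 ∷ []) n
enum-owing≗P (suc n) (suc d)       = ≗-trans (enum-owing-step (suc d) (owing (3 +ℕ d) ∷ []) n) (enum-owing≗P n d)

enum-owing≗Q : ∀ n d → enum (owing d) (owing (2 +ℕ d) ∷ owing (1 +ℕ d) ∷ []) n ≗ Q (2 +ℕ n ∸ d)
enum-owing≗Q zero    zero          zero          = refl
enum-owing≗Q zero    zero          (suc zero)    = refl
enum-owing≗Q zero    zero          (suc (suc k)) = refl
enum-owing≗Q zero    (suc zero)    zero          = refl
enum-owing≗Q zero    (suc zero)    (suc k)       = refl
enum-owing≗Q zero    (suc (suc d)) k rewrite 0∸n≡0 d = refl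
enum-owing≗Q (suc n) zero          = enum-owing-step 0 (owing 2 ∷ owing 1 ∷ []) n
enum-owing≗Q (suc n) (suc d)       = ≗-trans (enum-owing-step (suc d) (owing (3 +ℕ d) ∷ owing (2 +ℕ d) ∷ []) n)
                                              (enum-owing≗Q n d)

enum-inRun≗skipSum-P : ∀ n d → enum (inRun (suc d)) (owing d ∷ []) n ≗ skipSum P (n ∸ d)
enum-inRun≗skipSum-P zero    d k rewrite 0∸n≡0 d = refl
enum-inRun≗skipSum-P (suc n) d = begin
  enum (inRun (suc d)) (owing d ∷ []) (suc n)
    ≈⟨ enum-step (inRun (suc d)) (owing d ∷ []) n ⟩
  enum (owing (suc d)) (inRun (2 +ℕ d) ∷ δ (owing d) false ∷ []) n
    ⊕ enum (inRun (2 +ℕ d)) (owing (suc d) ∷ dead ∷ []) n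
    ≈⟨ ⊕-cong (enum-↭ (owing (suc d)) n (shift (δ (owing d) false) (inRun (2 +ℕ d) ∷ []) []))
              (enum-drop-dead _ (owing (suc d) ∷ []) [] n) ⟩
  enum (owing (suc d)) (δ (owing d) false ∷ inRun (2 +ℕ d) ∷ []) n
    ⊕ enum (inRun (2 +ℕ d)) (owing (suc d) ∷ []) n
    ≈⟨ ⊕-cong (enum-absorb (inRun (2 +ℕ d) ∷ []) n (owing-suc≼δ-owing d)) (enum-inRun≗skipSum-P n (suc d)) ⟩
  X· (enum (owing (suc d)) (inRun (2 +ℕ d) ∷ []) n) ⊕ skipSum P (n ∸ suc d)
    ≈⟨ ⊕-cong (X·-cong (≗-trans (enum-agree _ [] n (inRun-suc≈owing (suc d))) (enum-owing≗P n (suc d))))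
              ≗-refl ⟩
  X· (P (suc n ∸ d)) ⊕ skipSum P (n ∸ suc d)
    ≈⟨ skipSum-step P (λ _ → refl) n d ⟩
  skipSum P (suc n ∸ d) ∎
  where open ≗-Reasoning

enum-inRun≗skipSum-Q : ∀ n d → enum (inRun (suc d)) (owing d ∷ inRun (2 +ℕ d) ∷ []) n ≗ skipSum Q (n ∸ d)
enum-inRun≗skipSum-Q zero    d k rewrite 0∸n≡0 d = refl
enum-inRun≗skipSum-Q (suc n) d = begin
  enum (inRun (suc d)) (owing d ∷ inRun (2 +ℕ d) ∷ []) (suc n)
    ≈⟨ enum-step (inRun (suc d)) (owing d ∷ inRun (2 +ℕ d) ∷ []) n ⟩
  enum (owing (suc d)) (inRun (2 +ℕ d) ∷ δ (owing d) false ∷ owing (2 +ℕ d) ∷ []) n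
    ⊕ enum (inRun (2 +ℕ d)) (owing (suc d) ∷ dead ∷ inRun (3 +ℕ d) ∷ []) n
    ≈⟨ ⊕-cong (enum-↭ (owing (suc d)) n (shift (δ (owing d) false) (inRun (2 +ℕ d) ∷ []) (owing (2 +ℕ d) ∷ [])))
              (enum-drop-dead _ (owing (suc d) ∷ []) (inRun (3 +ℕ d) ∷ []) n) ⟩
  enum (owing (suc d)) (δ (owing d) false ∷ inRun (2 +ℕ d) ∷ owing (2 +ℕ d) ∷ []) n
    ⊕ enum (inRun (2 +ℕ d)) (owing (suc d) ∷ inRun (3 +ℕ d) ∷ []) n
    ≈⟨ ⊕-cong (enum-absorb (inRun (2 +ℕ d) ∷ owing (2 +ℕ d) ∷ []) n (owing-suc≼δ-owing d))
              (enum-inRun≗skipSum-Q n (suc d)) ⟩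
  X· (enum (owing (suc d)) (inRun (2 +ℕ d) ∷ owing (2 +ℕ d) ∷ []) n) ⊕ skipSum Q (n ∸ suc d)
    ≈⟨ ⊕-cong (X·-cong (≗-trans (enum-agree _ (owing (2 +ℕ d) ∷ []) n (inRun-suc≈owing (suc d)))
                                 (enum-owing≗Q n (suc d))))
              ≗-refl ⟩
  X· (Q (suc n ∸ d)) ⊕ skipSum Q (n ∸ suc d)
    ≈⟨ skipSum-step Q (λ _ → refl) n d ⟩
  skipSum Q (suc n ∸ d) ∎
  where open ≗-Reasoning

G₁ G₂ A B : ℕ → Poly
G₁ = enum free (inRun 0 ∷ [])
G₂ = enum free (inRun 0 ∷ owing 0 ∷ [])
A  = enum (inRun 0) []
B  = enum (inRun 0) (inRun 1 ∷ [])

A-split : ∀ n → A n ≗ P (suc n) ⊕ skipSum′ P n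
A-split zero    zero    = refl
A-split zero    (suc k) = refl
A-split (suc n) = ≗-trans (enum-step (inRun 0) [] n)
  (⊕-cong (≗-trans (enum-agree _ [] n (inRun-suc≈owing 0)) (enum-owing≗P n 0)) (enum-inRun≗skipSum-P n 0))

B-split : ∀ n → B n ≗ Q (suc n) ⊕ skipSum′ Q n
B-split zero    zero    = refl
B-split zero    (suc k) = refl
B-split (suc n) = ≗-trans (enum-step (inRun 0) (inRun 1 ∷ []) n)
  (⊕-cong (≗-trans (enum-agree _ (owing 1 ∷ []) n (inRun-suc≈owing 0)) (enum-owing≗Q n 0))
          (enum-inRun≗skipSum-Q n 0))

G₂-with-free : ∀ n → enum free (inRun 0 ∷ owing 0 ∷ free ∷ []) n ≗ X· (G₂ n)
G₂-with-free n =
  ≗-trans (enum-↭ free n (shift free (inRun 0 ∷ owing 0 ∷ []) []))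
          (enum-absorb (inRun 0 ∷ owing 0 ∷ []) n (λ _ h → h))

g-step : ∀ n → enum free [] (suc n) ≗ G₁ n ⊕ X· (P (suc n) ⊕ skipSum′ P n)
g-step n = ≗-trans (enum-step free [] n)
  (⊕-congˡ (G₁ n) (≗-trans (enum-absorb [] n inRun0≼free) (X·-cong (A-split n))))

G₁-step : ∀ n → G₁ (suc n) ≗ G₂ n ⊕ X· (Q (suc n) ⊕ skipSum′ Q n)
G₁-step n = ≗-trans (enum-step free (inRun 0 ∷ []) n)
  (⊕-congˡ (G₂ n) (≗-trans (enum-absorb (inRun 1 ∷ []) n inRun0≼free) (X·-cong (B-split n))))

G₂-step : ∀ n → G₂ (suc n) ≗ X· (G₂ n) ⊕ X· (Q (suc n) ⊕ skipSum′ Q n)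
G₂-step n = ≗-trans (enum-step free (inRun 0 ∷ owing 0 ∷ []) n)
  (⊕-cong (G₂-with-free n)
          (≗-trans (enum-absorb (inRun 1 ∷ dead ∷ []) n inRun0≼free)
                   (X·-cong (≗-trans (enum-drop-dead _ (inRun 1 ∷ []) [] n) (B-split n)))))

P-step : ∀ n → P (4 +ℕ n) ≗ G₂ n ⊕ X· (P (suc n) ⊕ skipSum′ P n)
P-step n = ≗-trans (enum-step free (owing 1 ∷ []) n)
  (⊕-congˡ (G₂ n) (≗-trans (enum-absorb (dead ∷ []) n inRun0≼free)
                           (X·-cong (≗-trans (enum-drop-dead _ [] [] n) (A-split n)))))

Q-step : ∀ n → Q (4 +ℕ n) ≗ X· (G₂ n) ⊕ X· (P (suc n) ⊕ skipSum′ P n)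
Q-step n = ≗-trans (enum-step free (owing 1 ∷ owing 0 ∷ []) n)
  (⊕-cong (G₂-with-free n)
          (≗-trans (enum-absorb (dead ∷ dead ∷ []) n inRun0≼free)
                   (X·-cong (≗-trans (enum-drop-dead _ [] (dead ∷ []) n)
                                     (≗-trans (enum-drop-dead _ [] [] n) (A-split n))))))

record LinearOps (A : Set) : Set where
  infixl 6 _+_ _-_
  field
    _+_ _-_ : A → A → A
    x·      : A → A

module _ {A : Set} (ops : LinearOps A) where
  open LinearOps ops

  step : Vec A 13 → Vec A 13
  step (g ∷ g₁ ∷ g₂ ∷ p₃ ∷ p₂ ∷ p₁ ∷ q₃ ∷ q₂ ∷ q₁ ∷ s ∷ s′ ∷ t ∷ t′ ∷ []) =
    g₁ + x· a ∷ g₂ + x· b ∷ x· g₂ + x· b ∷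
    g₂ + x· a ∷ p₃ ∷ p₂ ∷ x· g₂ + x· a ∷ q₃ ∷ q₂ ∷
    x· p₁ + s′ ∷ s ∷ x· q₁ + t′ ∷ t ∷ []
    where
    a b : A
    a = p₁ + s′
    b = q₁ + t′

  recurrence : (Fin 12 → A) → A
  recurrence h =
    x· (h (# 1)) + (h (# 2) + h (# 2)) - x· (h (# 3)) - h (# 4)
    + x· (x·-1 (h (# 5)))
    - x· (x· (x· (h (# 7))) - h (# 7))
    - (x· (x· (x·-1 (x·-1 (h (# 9))))) + x· (x· (x·-1 (x·-1 (h (# 9))))))
    - x· (x· (x·-1 (x·-1 (x·-1 (h (# 11))))))
    where
    x·-1 : A → A
    x·-1 a = x· a - a

module Related {A B : Set} (opsA : LinearOps A) (opsB : LinearOps B) (R : A → B → Set) where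
  private
    module A = LinearOps opsA
    module B = LinearOps opsB

  module Preserved (R+ : ∀ {a a′ b b′} → R a b → R a′ b′ → R (a A.+ a′) (b B.+ b′))
           (R- : ∀ {a a′ b b′} → R a b → R a′ b′ → R (a A.- a′) (b B.- b′))
           (Rx : ∀ {a b} → R a b → R (A.x· a) (B.x· b)) where

    step-pres : ∀ {u v} → Pointwise R u v → Pointwise R (step opsA u) (step opsB v)
    step-pres (g ∷ g₁ ∷ g₂ ∷ p₃ ∷ p₂ ∷ p₁ ∷ q₃ ∷ q₂ ∷ q₁ ∷ s ∷ s′ ∷ t ∷ t′ ∷ []) =
      R+ g₁ (Rx a) ∷ R+ g₂ (Rx b) ∷ R+ (Rx g₂) (Rx b) ∷ R+ g₂ (Rx a) ∷
      p₃ ∷ p₂ ∷ R+ (Rx g₂) (Rx a) ∷ q₃ ∷ q₂ ∷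
      R+ (Rx p₁) s′ ∷ s ∷ R+ (Rx q₁) t′ ∷ t ∷ []
      where
      a = R+ p₁ s′
      b = R+ q₁ t′

    recurrence-pres : ∀ {h h′} → (∀ i → R (h i) (h′ i)) → R (recurrence opsA h) (recurrence opsB h′)
    recurrence-pres r =
      R- (R- (R- (R+ (R- (R- (R+ (Rx (r (# 1))) (R+ (r (# 2)) (r (# 2)))) (Rx (r (# 3)))) (r (# 4)))
                     (Rx (Rx-1 (r (# 5)))))
                 (Rx (R- (Rx (Rx (r (# 7)))) (r (# 7)))))
             (R+ nine nine))
         (Rx (Rx (Rx-1 (Rx-1 (Rx-1 (r (# 11)))))))
      where
      Rx-1 : ∀ {a b} → R a b → R (A.x· a A.- a) (B.x· b B.- b)
      Rx-1 e = R- (Rx e) e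
      nine = Rx (Rx (Rx-1 (Rx-1 (r (# 9)))))

polyOps : LinearOps Poly
polyOps = record { _+_ = _⊕_ ; _-_ = _⊖_ ; x· = X· }

V : ℕ → Vec Poly 13
V n = enum free [] n ∷ G₁ n ∷ G₂ n ∷
      P (3 +ℕ n) ∷ P (2 +ℕ n) ∷ P (1 +ℕ n) ∷ Q (3 +ℕ n) ∷ Q (2 +ℕ n) ∷ Q (1 +ℕ n) ∷
      skipSum P n ∷ skipSum′ P n ∷ skipSum Q n ∷ skipSum′ Q n ∷ []

step-V : ∀ n → Pointwise _≗_ (step polyOps (V n)) (V (suc n))
step-V n =
  ≗-sym (g-step n) ∷ ≗-sym (G₁-step n) ∷ ≗-sym (G₂-step n) ∷ ≗-sym (P-step n) ∷ ≗-refl ∷ ≗-refl ∷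
  ≗-sym (Q-step n) ∷ ≗-refl ∷ ≗-refl ∷ ≗-refl ∷ ≗-refl ∷ ≗-refl ∷ ≗-refl ∷ []

pointwise-from-coefficients : ∀ {n} {u v : Vec Poly n} →
  (∀ k → Vec.map (λ p → p k) u ≡ Vec.map (λ p → p k) v) → Pointwise _≗_ u v
pointwise-from-coefficients {u = []}    {[]}    e = []
pointwise-from-coefficients {u = _ ∷ _} {_ ∷ _} e =
  (λ k → cong Vec.head (e k)) ∷ pointwise-from-coefficients (λ k → cong Vec.tail (e k))

-- The state at length −1: the residual below vanishes only after 13 steps, so n = 12 starts here.
V₋₁ : Vec Poly 13
V₋₁ = 0ₚ ∷ 1ₚ ∷ X· 1ₚ ∷ P 2 ∷ P 1 ∷ P 0 ∷ Q 2 ∷ Q 1 ∷ Q 0 ∷ 0ₚ ∷ 0ₚ ∷ 0ₚ ∷ 0ₚ ∷ []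

step-V₋₁ : Pointwise _≗_ (step polyOps V₋₁) (V 0)
step-V₋₁ = pointwise-from-coefficients
  (λ { 0 → refl ; 1 → refl ; 2 → refl ; (suc (suc (suc _))) → refl })

V⁺ : ℕ → Vec Poly 13
V⁺ zero    = V₋₁
V⁺ (suc n) = V n

step-V⁺ : ∀ n → Pointwise _≗_ (step polyOps (V⁺ n)) (V⁺ (suc n))
step-V⁺ zero    = step-V₋₁
step-V⁺ (suc n) = step-V n

infixl 6 _+ᶜ_
_+ᶜ_ : List ℤ → List ℤ → List ℤ
[]      +ᶜ q       = q
(a ∷ p) +ᶜ []      = a ∷ p
(a ∷ p) +ᶜ (b ∷ q) = (a +ℤ b) ∷ (p +ᶜ q)

-ᶜ_ : List ℤ → List ℤ
-ᶜ_ = map -_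

xᶜ : List ℤ → List ℤ
xᶜ = + 0 ∷_

isZeroᶜ : List ℤ → Bool
isZeroᶜ []        = true
isZeroᶜ (+ 0 ∷ p) = isZeroᶜ p
isZeroᶜ (_ ∷ _)   = false

-- A coefficient list c₀ ∷ c₁ ∷ … stands for c₀ + c₁ x + … ∈ ℤ[x], acting on polynomials by multiplication.
⟦_⟧ᶜ : List ℤ → Poly → Poly
⟦ []     ⟧ᶜ v = 0ₚ
⟦ c ∷ cs ⟧ᶜ v = (λ k → c * v k) ⊕ X· (⟦ cs ⟧ᶜ v)

⟦+ᶜ⟧ : ∀ p q v → ⟦ p +ᶜ q ⟧ᶜ v ≗ ⟦ p ⟧ᶜ v ⊕ ⟦ q ⟧ᶜ v
⟦+ᶜ⟧ []      q       v k = sym (ℤ.+-identityˡ _)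
⟦+ᶜ⟧ (a ∷ p) []      v k = sym (ℤ.+-identityʳ _)
⟦+ᶜ⟧ (a ∷ p) (b ∷ q) v k =
  trans (cong₂ _+ℤ_ (ℤ.*-distribʳ-+ (v k) a b) (≗-trans (X·-cong (⟦+ᶜ⟧ p q v)) (X·-⊕ _ _) k))
        (interchange (a * v k) (b * v k) _ _)

⟦-ᶜ⟧ : ∀ p v → ⟦ -ᶜ p ⟧ᶜ v ≗ ⊝ ⟦ p ⟧ᶜ v
⟦-ᶜ⟧ []      v k = refl
⟦-ᶜ⟧ (a ∷ p) v k =
  trans (cong₂ _+ℤ_ (sym (ℤ.neg-distribˡ-* a (v k))) (≗-trans (X·-cong (⟦-ᶜ⟧ p v)) (X·-⊝ _) k))
        (sym (ℤ.neg-distrib-+ (a * v k) _))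

⟦xᶜ⟧ : ∀ p v → ⟦ xᶜ p ⟧ᶜ v ≗ X· (⟦ p ⟧ᶜ v)
⟦xᶜ⟧ p v k = ℤ.+-identityˡ _

⟦zero⟧ᶜ : ∀ p v → T (isZeroᶜ p) → ⟦ p ⟧ᶜ v ≗ 0ₚ
⟦zero⟧ᶜ []        v _ k = refl
⟦zero⟧ᶜ (+ 0 ∷ p) v z k = cong (+ 0 +ℤ_) (≗-trans (X·-cong (⟦zero⟧ᶜ p v z)) X·-0ₚ k)

Form : ℕ → Set
Form m = Vec (List ℤ) m

infixl 6 _+ᶠ_ _-ᶠ_
_+ᶠ_ _-ᶠ_ : ∀ {m} → Form m → Form m → Form m
f +ᶠ f′ = zipWith _+ᶜ_ f f′
f -ᶠ f′ = f +ᶠ Vec.map -ᶜ_ f′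

formOps : ∀ {m} → LinearOps (Form m)
formOps = record { _+_ = _+ᶠ_ ; _-_ = _-ᶠ_ ; x· = Vec.map xᶜ }

unit : ∀ {m} → Fin m → Form m
unit zero    = (+ 1 ∷ []) ∷ replicate _ []
unit (suc i) = [] ∷ unit i

isZeroᶠ : ∀ {m} → Form m → Bool
isZeroᶠ []      = true
isZeroᶠ (p ∷ f) = isZeroᶜ p ∧ isZeroᶠ f

⟦_⟧ᶠ : ∀ {m} → Form m → Vec Poly m → Poly
⟦ []    ⟧ᶠ []      = 0ₚ
⟦ p ∷ f ⟧ᶠ (v ∷ ρ) = ⟦ p ⟧ᶜ v ⊕ ⟦ f ⟧ᶠ ρ

⟦+ᶠ⟧ : ∀ {m} (f f′ : Form m) ρ → ⟦ f +ᶠ f′ ⟧ᶠ ρ ≗ ⟦ f ⟧ᶠ ρ ⊕ ⟦ f′ ⟧ᶠ ρ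
⟦+ᶠ⟧ []      []        []      k = refl
⟦+ᶠ⟧ (p ∷ f) (p′ ∷ f′) (v ∷ ρ) k =
  trans (cong₂ _+ℤ_ (⟦+ᶜ⟧ p p′ v k) (⟦+ᶠ⟧ f f′ ρ k))
        (interchange (⟦ p ⟧ᶜ v k) (⟦ p′ ⟧ᶜ v k) (⟦ f ⟧ᶠ ρ k) (⟦ f′ ⟧ᶠ ρ k))

⟦-ᶠ⟧ : ∀ {m} (f f′ : Form m) ρ → ⟦ f -ᶠ f′ ⟧ᶠ ρ ≗ ⟦ f ⟧ᶠ ρ ⊖ ⟦ f′ ⟧ᶠ ρ
⟦-ᶠ⟧ f f′ ρ k = trans (⟦+ᶠ⟧ f (Vec.map -ᶜ_ f′) ρ k) (cong (⟦ f ⟧ᶠ ρ k +ℤ_) (negated f′ ρ k))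
  where
  negated : ∀ {m} (f : Form m) ρ → ⟦ Vec.map -ᶜ_ f ⟧ᶠ ρ ≗ ⊝ ⟦ f ⟧ᶠ ρ
  negated []      []      k = refl
  negated (p ∷ f) (v ∷ ρ) k = trans (cong₂ _+ℤ_ (⟦-ᶜ⟧ p v k) (negated f ρ k))
                                    (sym (ℤ.neg-distrib-+ (⟦ p ⟧ᶜ v k) (⟦ f ⟧ᶠ ρ k)))

⟦xᶠ⟧ : ∀ {m} (f : Form m) ρ → ⟦ Vec.map xᶜ f ⟧ᶠ ρ ≗ X· (⟦ f ⟧ᶠ ρ)
⟦xᶠ⟧ []      []      k = sym (X·-0ₚ k)
⟦xᶠ⟧ (p ∷ f) (v ∷ ρ) k = trans (cong₂ _+ℤ_ (⟦xᶜ⟧ p v k) (⟦xᶠ⟧ f ρ k)) (sym (X·-⊕ _ _ k))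

⟦zero⟧ᶠ : ∀ {m} (f : Form m) ρ → T (isZeroᶠ f) → ⟦ f ⟧ᶠ ρ ≗ 0ₚ
⟦zero⟧ᶠ []      []      _ k = refl
⟦zero⟧ᶠ (p ∷ f) (v ∷ ρ) z k =
  cong₂ _+ℤ_ (⟦zero⟧ᶜ p v (proj₁ both) k) (⟦zero⟧ᶠ f ρ (proj₂ both) k)
  where both = Equivalence.to T-∧ z

⟦unit⟧ : ∀ {m} (i : Fin m) ρ → ⟦ unit i ⟧ᶠ ρ ≗ lookup ρ i
⟦unit⟧ zero    (v ∷ ρ) k =
  trans (cong₂ _+ℤ_ (cong₂ _+ℤ_ (ℤ.*-identityˡ (v k)) (X·-0ₚ k))
                    (⟦zero⟧ᶠ (replicate _ []) ρ (all-zero ρ) k))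
        (trans (ℤ.+-identityʳ _) (ℤ.+-identityʳ _))
  where
  all-zero : ∀ {m} (ρ : Vec Poly m) → T (isZeroᶠ (replicate m []))
  all-zero []      = tt
  all-zero (_ ∷ ρ) = all-zero ρ
⟦unit⟧ (suc i) (v ∷ ρ) k = trans (ℤ.+-identityˡ _) (⟦unit⟧ i ρ k)

-- symbolicV j expresses V⁺ (j + m) as ℤ[x]-linear forms in the thirteen entries of V⁺ m, for every m.
symbolicV : ℕ → Vec (Form 13) 13
symbolicV zero    = tabulate unit
symbolicV (suc j) = step formOps (symbolicV j)

symbolic-g : Fin 12 → Form 13
symbolic-g i = lookup (symbolicV (13 ∸ toℕ i)) zero

residual : Form 13
residual = symbolic-g zero -ᶠ recurrence formOps symbolic-g

residual-vanishes : T (isZeroᶠ residual)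
residual-vanishes = tt

module _ (m : ℕ) where
  Represents : Form 13 → Poly → Set
  Represents f p = ⟦ f ⟧ᶠ (V⁺ m) ≗ p

  represents-⊕ : ∀ {f f′ p p′} → Represents f p → Represents f′ p′ → Represents (f +ᶠ f′) (p ⊕ p′)
  represents-⊕ {f} {f′} e e′ = ≗-trans (⟦+ᶠ⟧ f f′ (V⁺ m)) (⊕-cong e e′)

  represents-⊖ : ∀ {f f′ p p′} → Represents f p → Represents f′ p′ → Represents (f -ᶠ f′) (p ⊖ p′)
  represents-⊖ {f} {f′} e e′ = ≗-trans (⟦-ᶠ⟧ f f′ (V⁺ m)) (⊖-cong e e′)

  represents-X· : ∀ {f p} → Represents f p → Represents (Vec.map xᶜ f) (X· p)
  represents-X· {f} e = ≗-trans (⟦xᶠ⟧ f (V⁺ m)) (X·-cong e)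

  open Related.Preserved formOps polyOps Represents
    (λ {f} {f′} → represents-⊕ {f} {f′}) (λ {f} {f′} → represents-⊖ {f} {f′}) (λ {f} → represents-X· {f})

  symbolicV-sound : ∀ j → Pointwise Represents (symbolicV j) (V⁺ (j +ℕ m))
  symbolicV-sound zero =
    subst (Pointwise Represents (tabulate unit)) (tabulate∘lookup (V⁺ m))
          (tabulate⁺ {f = unit} (λ i → ⟦unit⟧ i (V⁺ m)))
  symbolicV-sound (suc j) = Pointwise.trans ≗-trans (step-pres (symbolicV-sound j)) (step-V⁺ (j +ℕ m))

  g-entries : Fin 12 → Poly
  g-entries i = g (12 +ℕ m ∸ toℕ i)

  symbolic-g-sound : ∀ i → Represents (symbolic-g i) (g-entries i)
  symbolic-g-sound i = ≗-trans
    (subst (λ j → Represents (symbolic-g i) (lookup (V⁺ j) zero)) (length-index i)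
           (Pointwise.lookup (symbolicV-sound (13 ∸ toℕ i)) zero))
    (≗-sym (g≗enum (12 +ℕ m ∸ toℕ i)))
    where
    length-index : ∀ (i : Fin 12) → 13 ∸ toℕ i +ℕ m ≡ suc (12 +ℕ m ∸ toℕ i)
    length-index i = trans (sym (+-∸-comm m (m≤n⇒m≤1+n (toℕ≤n i))))
                           (+-∸-assoc 1 (≤-trans (toℕ≤n i) (m≤m+n 12 m)))

  g-recurrence : g (12 +ℕ m) ≗ recurrence polyOps g-entries
  g-recurrence k = ℤ.i-j≡0⇒i≡j _ _ (trans (sym (difference k)) (⟦zero⟧ᶠ residual (V⁺ m) residual-vanishes k))
    where
    rhs = recurrence polyOps g-entries
    difference : Represents residual (g (12 +ℕ m) ⊖ rhs)
    difference = represents-⊖ {symbolic-g zero} {recurrence formOps symbolic-g} {g (12 +ℕ m)} {rhs}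
                               (symbolic-g-sound zero) (recurrence-pres {symbolic-g} {g-entries} symbolic-g-sound)

theorem6p8 : (n : ℕ) → 12 ≤ n → (k : ℕ) →
    g n k ≡
      ( X· (g (n ∸ 1)) ⊕ (g (n ∸ 2) ⊕ g (n ∸ 2)) ⊖ X· (g (n ∸ 3)) ⊖ g (n ∸ 4)
      ⊕ X· (X-1· (g (n ∸ 5)))
      ⊖ X· (X· (X· (g (n ∸ 7))) ⊖ g (n ∸ 7))
      ⊖ (X· (X· (X-1· (X-1· (g (n ∸ 9))))) ⊕ X· (X· (X-1· (X-1· (g (n ∸ 9))))))
      ⊖ X· (X· (X-1· (X-1· (X-1· (g (n ∸ 11))))))
      ) k
theorem6p8 n 12≤n with m≤n⇒∃[o]m+o≡n 12≤n
... | m , refl = g-recurrence m
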